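{- Let $G$ be a graph, $x^0$ an optimal basic feasible solution of $\mathrm{ELP}(G)$ with objective value $z(x^0)$, $I_0=\{i: x^0_i=0\}$, $I_1=\{i: x^0_i=1\}$, and $\acute G=G\setminus(I_0\cup I_1)$ (delete these vertices and incident edges). Let $\acute x$ be an optimal basic feasible solution of $\mathrm{ELP}(\acute G)$ with objective value $\acute z(\acute x)$. If $R$ is a vertex cover of $\acute G$, then $R\cup I_1$ is a vertex cover of $G$. Further, $\acute z(\acute x)\le z(x^0)-|I_1|$.
   Context: For a graph $H$, $\mathrm{ELP}(H)$ is the linear program: minimize $\sum_{v\in V(H)} x_v$ subject to $x_u+x_v\ge 1$ for every edge $(u,v)$ of $H$, $\sum_{v\in V(C)} x_v\ge s+1$ for every odd cycle $C$ of $H$ with $2s+1$ vertices, and $x\ge 0$. A basic feasible solution is a vertex of its feasible polyhedron. A vertex cover is a vertex set meeting every edge.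
   Formalization: The optimal basic feasible solutions $x^0$ and $\acute x$, and the feasible points against which their optimality and extremality are tested, are taken to have rational coordinates. -}

module Defs where

open import Data.Bool using (Bool; true; false; _∧_; _∨_; not; if_then_else_)
open import Data.Bool.Properties using (∧-comm; ∧-assoc)
open import Data.Nat using (ℕ; zero; suc; _+_)
open import Data.Fin using (Fin; zero; suc; inject₁; fromℕ)
open import Data.Integer using (+_)
open import Data.Rational using (ℚ; 0ℚ; 1ℚ; _/_; _≤_; _<_) renaming (_+_ to _+ℚ_; _*_ to _*ℚ_; _-_ to _-ℚ_)
open import Data.Rational.Properties using (_≟_)
open import Data.Product using (_×_; _,_)
open import Function.Definitions using (Injective)
open import Relation.Nullary.Decidable using (⌊_⌋)
open import Relation.Binary.PropositionalEquality using (_≡_; refl; cong)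

ℕ→ℚ : ℕ → ℚ
ℕ→ℚ k = + k / 1

Σℚ : ∀ {n} → (Fin n → ℚ) → ℚ
Σℚ {zero}  f = 0ℚ
Σℚ {suc n} f = f zero +ℚ Σℚ (λ i → f (suc i))

count : ∀ {n} → (Fin n → Bool) → ℕ
count {zero}  P = 0
count {suc n} P = (if P zero then 1 else 0) + count (λ i → P (suc i))

-- A finite simple graph whose vertex set V is a subset of Fin n
-- (this lets vertex deletion keep the ambient index type).
record Graph (n : ℕ) : Set where
  field
    V      : Fin n → Bool
    E      : Fin n → Fin n → Bool
    sym    : ∀ u v → E u v ≡ E v u
    irrefl : ∀ v → E v v ≡ false
    closed : ∀ u v → E u v ≡ true → (V u ≡ true) × (V v ≡ true)
open Graph public

VSet : ℕ → Set
VSet n = Fin n → Bool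

private
  ∧-true : ∀ a b → a ∧ b ≡ true → (a ≡ true) × (b ≡ true)
  ∧-true true true refl = refl , refl

  swap3 : ∀ e a b → e ∧ (a ∧ b) ≡ e ∧ (b ∧ a)
  swap3 e a b = cong (e ∧_) (∧-comm a b)

induced : ∀ {n} → (G : Graph n) → VSet n → Graph n
induced {n} G keep = record
  { V      = V'
  ; E      = E'
  ; sym    = symP
  ; irrefl = irr
  ; closed = cl
  }
  where
  V' : VSet n
  V' v = V G v ∧ keep v
  E' : Fin n → Fin n → Bool
  E' u v = E G u v ∧ (V' u ∧ V' v)
  symP : ∀ u v → E' u v ≡ E' v u
  symP u v with E G u v | E G v u | sym G u v
  ... | e | .e | refl = swap3 e (V' u) (V' v)
  irr : ∀ v → E' v v ≡ false
  irr v with E G v v | irrefl G v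
  ... | .false | refl = refl
  cl : ∀ u v → E' u v ≡ true → (V' u ≡ true) × (V' v ≡ true)
  cl u v p with ∧-true (E G u v) _ p
  ... | _ , q = ∧-true (V' u) (V' v) q

_∖_ : ∀ {n} → Graph n → VSet n → Graph n
G ∖ D = induced G (λ v → not (D v))

record OddCycle {n : ℕ} (H : Graph n) : Set where
  field
    s     : ℕ
    s≥1   : Data.Nat._≤_ 1 s
    c     : Fin (suc (s + s)) → Fin n
    inj   : Injective _≡_ _≡_ c
    step  : ∀ (i : Fin (s + s)) → E H (c (inject₁ i)) (c (suc i)) ≡ true
    close : E H (c (fromℕ (s + s))) (c zero) ≡ true
open OddCycle public

-- Points: rational vectors indexed by Fin n; coordinates outside V(H)
-- are not variables of ELP(H) and are pinned to 0.
Point : ℕ → Set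
Point n = Fin n → ℚ

obj : ∀ {n} → Graph n → Point n → ℚ
obj H x = Σℚ (λ v → if V H v then x v else 0ℚ)

Feasible : ∀ {n} → Graph n → Point n → Set
Feasible {n} H x =
    (∀ v → V H v ≡ false → x v ≡ 0ℚ)
  × (∀ v → V H v ≡ true → 0ℚ ≤ x v)
  × (∀ u v → E H u v ≡ true → 1ℚ ≤ x u +ℚ x v)
  × (∀ (C : OddCycle H) → ℕ→ℚ (suc (s C)) ≤ Σℚ (λ i → x (c C i)))

BasicFeasible : ∀ {n} → Graph n → Point n → Set
BasicFeasible {n} H x =
  Feasible H x ×
  (∀ (y w : Point n) (λ′ : ℚ) → 0ℚ < λ′ → λ′ < 1ℚ →
     Feasible H y → Feasible H w →
     (∀ v → x v ≡ λ′ *ℚ y v +ℚ (1ℚ -ℚ λ′) *ℚ w v) →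
     ∀ v → y v ≡ w v)

Optimal : ∀ {n} → Graph n → Point n → Set
Optimal {n} H x = Feasible H x × (∀ (y : Point n) → Feasible H y → obj H x ≤ obj H y)

OptimalBFS : ∀ {n} → Graph n → Point n → Set
OptimalBFS H x = BasicFeasible H x × Optimal H x

VertexCover : ∀ {n} → Graph n → VSet n → Set
VertexCover H R = (∀ v → R v ≡ true → V H v ≡ true)
                × (∀ u v → E H u v ≡ true → R u ∨ R v ≡ true)

_∪_ : ∀ {n} → VSet n → VSet n → VSet n
(A ∪ B) v = A v ∨ B v

level : ∀ {n} → Graph n → Point n → ℚ → VSet n
level G x a v = V G v ∧ ⌊ x v ≟ a ⌋

module Submission where

-- Proof idea.  Let x be an optimal solution of ELP(G), I₀ = {x = 0}, I₁ = {x = 1} and G′ = G ∖ (I₀ ∪ I₁).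
--
-- (1) Every coordinate of x on V(G) is at most 1: otherwise capping it at 1
--     keeps all constraints (an odd cycle through a vertex of value ≥ 1 has
--     value ≥ s + 1 as soon as consecutive vertices sum to ≥ 1) and strictly
--     lowers the objective.  Hence an edge with an endpoint in I₀ has its
--     other endpoint in I₁, so every edge of G either survives in G′ or meets
--     I₁; a vertex cover R of G′ therefore extends to the cover R ∪ I₁ of G.
-- (2) The restriction of x to the induced subgraph G′ is feasible for
--     ELP(G′), and since x is 0 on I₀ and 1 on I₁ its G′-objective equals
--     z(x) − |I₁|; optimality of x́ for ELP(G′) gives the inequality.

open import Defs
open import Data.Bool using (Bool; true; false; if_then_else_; _∧_; _∨_; not)
open import Data.Bool.Properties using (∨-zeroʳ)
open import Data.Nat as ℕ using (ℕ; zero; suc; z≤n; s≤s)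
import Data.Nat.Properties as ℕP
open import Data.Integer as ℤ using (ℤ) renaming (+_ to +ℤ_)
open import Data.Integer.Tactic.RingSolver using (solve-∀)
open import Data.Rational as ℚ using (ℚ; 0ℚ; 1ℚ; _≤_; _<_; _+_; _-_)
import Data.Rational.Properties as ℚP
import Data.Rational.Unnormalised as ℚᵘ
import Data.Rational.Unnormalised.Properties as ℚᵘP
open import Data.Fin as Fin using (Fin; zero; suc; inject₁; fromℕ; toℕ)
import Data.Fin.Properties as FinP
open import Data.Product using (_×_; _,_; ∃; proj₁; proj₂)
open import Data.Sum using (_⊎_; inj₁; inj₂)
open import Data.Empty using (⊥-elim)
open import Relation.Nullary using (yes; no)
open import Relation.Binary.PropositionalEquality
  using (_≡_; _≢_; refl; trans; cong; cong₂; subst; subst₂; module ≡-Reasoning)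
  renaming (sym to ≡-sym)
open import Algebra.Bundles using (CommutativeMonoid)
open import Algebra.Properties.CommutativeSemigroup
  (CommutativeMonoid.commutativeSemigroup ℚP.+-0-commutativeMonoid) using (interchange)
open import Algebra.Properties.Group ℚP.+-0-group using (//-rightDividesʳ)

ℕ→ℚ-suc : ∀ k → ℕ→ℚ (suc k) ≡ 1ℚ + ℕ→ℚ k
ℕ→ℚ-suc k = ℚP.toℚᵘ-injective (begin
  ℚ.toℚᵘ (ℕ→ℚ (suc k))                    ≈⟨ ℚP.toℚᵘ-fromℚᵘ (ℚᵘ.mkℚᵘ (+ℤ suc k) 0) ⟩
  ℚᵘ.mkℚᵘ (+ℤ suc k) 0                    ≈⟨ ℚᵘ.*≡* (unit-cross (+ℤ k)) ⟩
  ℚᵘ.mkℚᵘ (+ℤ 1) 0 ℚᵘ.+ ℚᵘ.mkℚᵘ (+ℤ k) 0  ≈⟨ ℚᵘP.+-congʳ (ℚᵘ.mkℚᵘ (+ℤ 1) 0)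
                                                (ℚᵘP.≃-sym (ℚP.toℚᵘ-fromℚᵘ (ℚᵘ.mkℚᵘ (+ℤ k) 0))) ⟩
  ℚ.toℚᵘ 1ℚ ℚᵘ.+ ℚ.toℚᵘ (ℕ→ℚ k)           ≈⟨ ℚᵘP.≃-sym (ℚP.toℚᵘ-homo-+ 1ℚ (ℕ→ℚ k)) ⟩
  ℚ.toℚᵘ (1ℚ + ℕ→ℚ k)                     ∎)
  where
  open ℚᵘP.≃-Reasoning
  -- cross-multiplication identity behind  (1 + k)/1 ≃ 1/1 + k/1
  unit-cross : ∀ (i : ℤ) → (ℤ.1ℤ ℤ.+ i) ℤ.* ℤ.1ℤ ≡ (ℤ.1ℤ ℤ.* ℤ.1ℤ ℤ.+ i ℤ.* ℤ.1ℤ) ℤ.* ℤ.1ℤ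
  unit-cross = solve-∀

Σ-cong : ∀ {n} {f g : Fin n → ℚ} → (∀ i → f i ≡ g i) → Σℚ f ≡ Σℚ g
Σ-cong {zero}  f≡g = refl
Σ-cong {suc n} f≡g = cong₂ _+_ (f≡g zero) (Σ-cong (λ i → f≡g (suc i)))

Σ-+ : ∀ {n} (f g : Fin n → ℚ) → Σℚ (λ i → f i + g i) ≡ Σℚ f + Σℚ g
Σ-+ {zero}  f g = refl
Σ-+ {suc n} f g = begin
  (f zero + g zero) + Σℚ (λ i → f (suc i) + g (suc i))
    ≡⟨ cong ((f zero + g zero) +_) (Σ-+ (λ i → f (suc i)) (λ i → g (suc i))) ⟩
  (f zero + g zero) + (Σℚ (λ i → f (suc i)) + Σℚ (λ i → g (suc i)))
    ≡⟨ interchange (f zero) (g zero) _ _ ⟩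
  (f zero + Σℚ (λ i → f (suc i))) + (g zero + Σℚ (λ i → g (suc i))) ∎
  where open ≡-Reasoning

Σ-mono : ∀ {n} {f g : Fin n → ℚ} → (∀ i → f i ≤ g i) → Σℚ f ≤ Σℚ g
Σ-mono {zero}  f≤g = ℚP.≤-refl
Σ-mono {suc n} f≤g = ℚP.+-mono-≤ (f≤g zero) (Σ-mono (λ i → f≤g (suc i)))

Σ-strict : ∀ {n} {f g : Fin n → ℚ} → (∀ i → f i ≤ g i) → ∀ j → f j < g j → Σℚ f < Σℚ g
Σ-strict {suc n} f≤g zero    fj<gj = ℚP.+-mono-<-≤ fj<gj (Σ-mono (λ i → f≤g (suc i)))
Σ-strict {suc n} f≤g (suc j) fj<gj = ℚP.+-mono-≤-< (f≤g zero) (Σ-strict (λ i → f≤g (suc i)) j fj<gj)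

count-Σ : ∀ {n} (P : Fin n → Bool) → ℕ→ℚ (count P) ≡ Σℚ (λ i → if P i then 1ℚ else 0ℚ)
count-Σ {zero}  P = refl
count-Σ {suc n} P with P zero
... | true  = trans (ℕ→ℚ-suc (count (λ i → P (suc i)))) (cong (1ℚ +_) (count-Σ (λ i → P (suc i))))
... | false = trans (≡-sym (ℚP.+-identityˡ _)) (cong (0ℚ +_) (count-Σ (λ i → P (suc i))))

Σ< : ℕ → (ℕ → ℚ) → ℚ
Σ< n h = Σℚ {n} (λ i → h (toℕ i))

Σ<-last : ∀ n (h : ℕ → ℚ) → Σ< (suc n) h ≡ Σ< n h + h n
Σ<-last zero    h = trans (ℚP.+-identityʳ (h 0)) (≡-sym (ℚP.+-identityˡ (h 0)))
Σ<-last (suc n) h = begin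
  h 0 + Σ< (suc n) (λ i → h (suc i))      ≡⟨ cong (h 0 +_) (Σ<-last n (λ i → h (suc i))) ⟩
  h 0 + (Σ< n (λ i → h (suc i)) + h (suc n)) ≡⟨ ℚP.+-assoc (h 0) _ _ ⟨
  Σ< (suc n) h + h (suc n)                ∎
  where open ≡-Reasoning

Path : (ℕ → ℚ) → ℕ → Set
Path h n = ∀ i → suc i ℕ.< n → 1ℚ ≤ h i + h (suc i)

Path-tail : ∀ h {n} → Path h (suc n) → Path (λ i → h (suc i)) n
Path-tail h path i i<n = path (suc i) (s≤s i<n)

Path-tail₂ : ∀ h {n} → Path h (suc (suc n)) → Path (λ i → h (suc (suc i))) n
Path-tail₂ h path i i<n = path (suc (suc i)) (s≤s (s≤s i<n))

prepend-pair : ∀ h {n b} → Path h (suc (suc n)) → b ≤ Σ< n (λ i → h (suc (suc i))) →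
               1ℚ + b ≤ Σ< (suc (suc n)) h
prepend-pair h path b≤ = subst (_ ≤_) (ℚP.+-assoc (h 0) (h 1) _)
  (ℚP.+-mono-≤ (path 0 (s≤s (s≤s z≤n))) b≤)

-- A path with 2k terms has sum ≥ k (split it into k adjacent pairs).
path-even : ∀ k h → Path h (k ℕ.+ k) → ℕ→ℚ k ≤ Σ< (k ℕ.+ k) h
path-even zero    h path = ℚP.≤-refl
path-even (suc k) h path rewrite ℕP.+-suc k k =
  subst (_≤ Σ< (suc (suc (k ℕ.+ k))) h) (≡-sym (ℕ→ℚ-suc k))
    (prepend-pair h path (path-even k (λ i → h (suc (suc i))) (Path-tail₂ h path)))

-- A path with 2k+1 terms whose term at an even position 2p is ≥ 1 has sum ≥ k+1:
-- the anchor and k adjacent pairs cover all the terms.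
path-odd-anchored : ∀ k p h → p ℕ.≤ k → Path h (suc (k ℕ.+ k)) → 1ℚ ≤ h (p ℕ.+ p) →
                    ℕ→ℚ (suc k) ≤ Σ< (suc (k ℕ.+ k)) h
path-odd-anchored k zero h _ path anchor =
  subst (_≤ Σ< (suc (k ℕ.+ k)) h) (≡-sym (ℕ→ℚ-suc k))
    (ℚP.+-mono-≤ anchor (path-even k (λ i → h (suc i)) (Path-tail h path)))
path-odd-anchored (suc k) (suc p) h (s≤s p≤k) path anchor
  rewrite ℕP.+-suc k k | ℕP.+-suc p p =
  subst (_≤ Σ< (suc (suc (suc (k ℕ.+ k)))) h) (≡-sym (ℕ→ℚ-suc (suc k)))
    (prepend-pair h path
      (path-odd-anchored k p (λ i → h (suc (suc i))) p≤k (Path-tail₂ h path) anchor))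

rotate : (ℕ → ℚ) → ℕ → ℕ → ℚ
rotate h m zero    = h m
rotate h m (suc i) = h i

Σ<-rotate : ∀ m (h : ℕ → ℚ) → Σ< (suc m) (rotate h m) ≡ Σ< (suc m) h
Σ<-rotate m h = trans (ℚP.+-comm (h m) (Σ< m h)) (≡-sym (Σ<-last m h))

Path-rotate : ∀ h m → Path h (suc m) → 1ℚ ≤ h m + h 0 → Path (rotate h m) (suc m)
Path-rotate h m path closing zero    _             = closing
Path-rotate h m path closing (suc i) (s≤s i+1<m+1) = path i (ℕP.<-trans i+1<m+1 (ℕP.n<1+n _))

parity : ∀ j → (∃ λ p → j ≡ p ℕ.+ p) ⊎ (∃ λ p → j ≡ suc (p ℕ.+ p))
parity zero = inj₁ (0 , refl)
parity (suc j) with parity j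
... | inj₁ (p , refl) = inj₂ (p , refl)
... | inj₂ (p , refl) = inj₁ (suc p , cong suc (≡-sym (ℕP.+-suc p p)))

half-≤ : ∀ {p s} → p ℕ.+ p ℕ.≤ s ℕ.+ s → p ℕ.≤ s
half-≤ le = ℕP.≮⇒≥ (λ s<p → ℕP.<⇒≱ (ℕP.+-mono-< s<p s<p) le)

half-< : ∀ {p s} → p ℕ.+ p ℕ.< s ℕ.+ s → p ℕ.< s
half-< lt = ℕP.≰⇒> (λ s≤p → ℕP.<⇒≱ lt (ℕP.+-mono-≤ s≤p s≤p))

-- Odd-cycle bound: on a cycle of 2s+1 terms where consecutive terms (including the
-- closing pair) sum to ≥ 1, one term ≥ 1 forces the total to be ≥ s+1.  An odd anchor
-- position becomes even after one rotation.
cycle-anchored : ∀ s h → Path h (suc (s ℕ.+ s)) → 1ℚ ≤ h (s ℕ.+ s) + h 0 →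
                 ∀ j → j ℕ.≤ s ℕ.+ s → 1ℚ ≤ h j → ℕ→ℚ (suc s) ≤ Σ< (suc (s ℕ.+ s)) h
cycle-anchored s h path closing j j≤2s anchor with parity j
... | inj₁ (p , refl) = path-odd-anchored s p h (half-≤ j≤2s) path anchor
... | inj₂ (p , refl) = subst (ℕ→ℚ (suc s) ≤_) (Σ<-rotate (s ℕ.+ s) h)
      (path-odd-anchored s (suc p) (rotate h (s ℕ.+ s)) (half-< j≤2s)
        (Path-rotate h (s ℕ.+ s) path closing) anchor′)
  where
  anchor′ : 1ℚ ≤ rotate h (s ℕ.+ s) (suc p ℕ.+ suc p)
  anchor′ rewrite ℕP.+-suc p p = anchor

-- Reading a family indexed by Fin (suc m) as a sequence (indices beyond m clamp to m).
clamp : ∀ m → ℕ → Fin (suc m)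
clamp m       zero    = zero
clamp zero    (suc i) = zero
clamp (suc m) (suc i) = suc (clamp m i)

clamp-toℕ : ∀ m (j : Fin (suc m)) → clamp m (toℕ j) ≡ j
clamp-toℕ m       zero    = refl
clamp-toℕ (suc m) (suc j) = cong suc (clamp-toℕ m j)

clamp-last : ∀ m → clamp m m ≡ fromℕ m
clamp-last zero    = refl
clamp-last (suc m) = cong suc (clamp-last m)

Path-clamp : ∀ m (g : Fin (suc m) → ℚ) → (∀ (i : Fin m) → 1ℚ ≤ g (inject₁ i) + g (suc i)) →
             Path (λ i → g (clamp m i)) (suc m)
Path-clamp (suc m) g steps zero    _         = steps zero
Path-clamp (suc m) g steps (suc i) (s≤s i<m) =
  Path-clamp m (λ k → g (suc k)) (λ k → steps (suc k)) i i<m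
Path-clamp zero    g steps i       (s≤s ())

cycle-bound : ∀ s (g : Fin (suc (s ℕ.+ s)) → ℚ) →
              (∀ (i : Fin (s ℕ.+ s)) → 1ℚ ≤ g (inject₁ i) + g (suc i)) →
              1ℚ ≤ g (fromℕ (s ℕ.+ s)) + g zero →
              ∀ j → 1ℚ ≤ g j → ℕ→ℚ (suc s) ≤ Σℚ g
cycle-bound s g steps closing j anchor =
  subst (ℕ→ℚ (suc s) ≤_) (Σ-cong (λ i → cong g (clamp-toℕ (s ℕ.+ s) i)))
    (cycle-anchored s h (Path-clamp (s ℕ.+ s) g steps)
      (subst (λ k → 1ℚ ≤ g k + g zero) (≡-sym (clamp-last (s ℕ.+ s))) closing)
      (toℕ j) (ℕP.≤-pred (FinP.toℕ<n j))
      (subst (λ k → 1ℚ ≤ g k) (≡-sym (clamp-toℕ (s ℕ.+ s) j)) anchor))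
  where
  h : ℕ → ℚ
  h i = g (clamp (s ℕ.+ s) i)

≤-+ʳ : ∀ {p q t} → 0ℚ ≤ t → p ≤ q → p ≤ q + t
≤-+ʳ {q = q} 0≤t p≤q = ℚP.≤-trans p≤q (subst (_≤ q + _) (ℚP.+-identityʳ q) (ℚP.+-monoʳ-≤ q 0≤t))

0≤1 : 0ℚ ≤ 1ℚ
0≤1 = ℚP.nonNegative⁻¹ 1ℚ

cycle-vertex : ∀ {n} (H : Graph n) (C : OddCycle H) i → V H (c C i) ≡ true
cycle-vertex H C zero    = proj₂ (closed H _ _ (close C))
cycle-vertex H C (suc i) = proj₂ (closed H _ _ (step C i))

cap : ∀ {n} → Point n → Fin n → Point n
cap x v w with w Fin.≟ v
... | yes _ = 1ℚ
... | no  _ = x w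

cap-at : ∀ {n} (x : Point n) v → cap x v v ≡ 1ℚ
cap-at x v with v Fin.≟ v
... | yes _   = refl
... | no  v≢v = ⊥-elim (v≢v refl)

cap-off : ∀ {n} (x : Point n) {v w} → w ≢ v → cap x v w ≡ x w
cap-off x {v} {w} w≢v with w Fin.≟ v
... | yes w≡v = ⊥-elim (w≢v w≡v)
... | no  _   = refl

-- Capping a vertex of G at 1 preserves feasibility for ELP(G): edges at v are
-- covered by v alone, and odd cycles through v by the odd-cycle bound.
cap-feasible : ∀ {n} (G : Graph n) (x : Point n) v → V G v ≡ true →
               Feasible G x → Feasible G (cap x v)
cap-feasible G x v v∈G (zero-off , nonneg , edges , cycles) =
  zero-off′ , nonneg′ , edges′ , cycles′
  where
  zero-off′ : ∀ w → V G w ≡ false → cap x v w ≡ 0ℚ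
  zero-off′ w w∉G with w Fin.≟ v
  ... | yes refl with () ← trans (≡-sym v∈G) w∉G
  ... | no  _    = zero-off w w∉G

  nonneg′ : ∀ w → V G w ≡ true → 0ℚ ≤ cap x v w
  nonneg′ w w∈G with w Fin.≟ v
  ... | yes _ = 0≤1
  ... | no  _ = nonneg w w∈G

  edges′ : ∀ a b → E G a b ≡ true → 1ℚ ≤ cap x v a + cap x v b
  edges′ a b ab with a Fin.≟ v | b Fin.≟ v
  ... | yes _ | yes _ = ≤-+ʳ 0≤1 ℚP.≤-refl
  ... | yes _ | no  _ = ≤-+ʳ (nonneg b (proj₂ (closed G a b ab))) ℚP.≤-refl
  ... | no  _ | yes _ = subst (1ℚ ≤_) (ℚP.+-comm 1ℚ (x a))
                          (≤-+ʳ (nonneg a (proj₁ (closed G a b ab))) ℚP.≤-refl)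
  ... | no  _ | no  _ = edges a b ab

  cycles′ : ∀ (C : OddCycle G) → ℕ→ℚ (suc (s C)) ≤ Σℚ (λ i → cap x v (c C i))
  cycles′ C with FinP.any? (λ i → c C i Fin.≟ v)
  ... | yes (j , cj≡v) =
        cycle-bound (s C) (λ i → cap x v (c C i))
          (λ i → edges′ _ _ (step C i)) (edges′ _ _ (close C))
          j (subst (λ w → 1ℚ ≤ cap x v w) (≡-sym cj≡v) (ℚP.≤-reflexive (≡-sym (cap-at x v))))
  ... | no avoids =
        subst (ℕ→ℚ (suc (s C)) ≤_)
          (Σ-cong (λ i → ≡-sym (cap-off x (λ ci≡v → avoids (i , ci≡v)))))
          (cycles C)

-- The coordinates of x that are variables of ELP(H); note obj H x = Σℚ (restrict H x).
restrict : ∀ {n} → Graph n → Point n → Point n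
restrict H x w = if V H w then x w else 0ℚ

cap-lowers : ∀ {n} (G : Graph n) (x : Point n) v → V G v ≡ true → 1ℚ < x v →
             obj G (cap x v) < obj G x
cap-lowers G x v v∈G 1<xv = Σ-strict pointwise v strict
  where
  pointwise : ∀ w → restrict G (cap x v) w ≤ restrict G x w
  pointwise w with V G w
  ... | false = ℚP.≤-refl
  ... | true with w Fin.≟ v
  ...   | yes refl = ℚP.<⇒≤ 1<xv
  ...   | no  _    = ℚP.≤-refl
  strict : restrict G (cap x v) v < restrict G x v
  strict rewrite v∈G | cap-at x v = 1<xv

optimal-≤1 : ∀ {n} (G : Graph n) (x : Point n) → Optimal G x → ∀ v → V G v ≡ true → x v ≤ 1ℚ
optimal-≤1 G x (feasible , minimal) v v∈G with x v ℚ.≤? 1ℚ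
... | yes xv≤1 = xv≤1
... | no  xv≰1 = ⊥-elim (ℚP.<-irrefl refl (ℚP.≤-<-trans
                   (minimal (cap x v) (cap-feasible G x v v∈G feasible))
                   (cap-lowers G x v v∈G (ℚP.≰⇒> xv≰1))))

optimal-forces-one : ∀ {n} (G : Graph n) (x : Point n) → Optimal G x →
                     ∀ u w → E G u w ≡ true → x u ≡ 0ℚ → x w ≡ 1ℚ
optimal-forces-one G x optimal@((_ , _ , edges , _) , _) u w uw xu≡0 = ℚP.≤-antisym
  (optimal-≤1 G x optimal w (proj₂ (closed G u w uw)))
  (subst (1ℚ ≤_) (trans (cong (_+ x w) xu≡0) (ℚP.+-identityˡ (x w))) (edges u w uw))

∧-trueˡ : ∀ {a b} → a ∧ b ≡ true → a ≡ true
∧-trueˡ {true} _ = refl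

∨-trueˡ : ∀ {a} b → a ≡ true → a ∨ b ≡ true
∨-trueˡ b refl = refl

∨-trueʳ : ∀ a {b} → b ≡ true → a ∨ b ≡ true
∨-trueʳ a refl = ∨-zeroʳ a

∨-true-cases : ∀ a {b} → a ∨ b ≡ true → (a ≡ true) ⊎ (b ≡ true)
∨-true-cases true  _  = inj₁ refl
∨-true-cases false ab = inj₂ ab

bool-cases : ∀ b → (b ≡ true) ⊎ (b ≡ false)
bool-cases true  = inj₁ refl
bool-cases false = inj₂ refl

level-value : ∀ {n} (G : Graph n) (x : Point n) a w → level G x a w ≡ true → x w ≡ a
level-value G x a w w∈I with V G w | x w ℚP.≟ a | w∈I
... | true | yes xw≡a | _ = xw≡a

level-intro : ∀ {n} (G : Graph n) (x : Point n) a w → V G w ≡ true → x w ≡ a → level G x a w ≡ true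
level-intro G x a w w∈G xw≡a rewrite w∈G with x w ℚP.≟ a
... | yes _   = refl
... | no  xw≢a = ⊥-elim (xw≢a xw≡a)

edge-survives : ∀ {n} (G : Graph n) (D : VSet n) u w → E G u w ≡ true →
                D u ≡ false → D w ≡ false → E (G ∖ D) u w ≡ true
edge-survives G D u w uw u∉D w∉D
  rewrite uw | proj₁ (closed G u w uw) | proj₂ (closed G u w uw) | u∉D | w∉D = refl

I₀-neighbour-in-I₁ : ∀ {n} (G : Graph n) (x : Point n) → Optimal G x → ∀ u w → E G u w ≡ true →
                     level G x 0ℚ u ≡ true → level G x 1ℚ w ≡ true
I₀-neighbour-in-I₁ G x optimal u w uw u∈I₀ = level-intro G x 1ℚ w (proj₂ (closed G u w uw))
  (optimal-forces-one G x optimal u w uw (level-value G x 0ℚ u u∈I₀))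

-- For optimal x, every edge of G meets I₁ or survives in G ∖ (I₀ ∪ I₁): an end in
-- I₀ would force the other end into I₁.
edge-fate : ∀ {n} (G : Graph n) (x : Point n) → Optimal G x → ∀ u w → E G u w ≡ true →
            (level G x 1ℚ u ≡ true) ⊎ (level G x 1ℚ w ≡ true)
            ⊎ (E (G ∖ (level G x 0ℚ ∪ level G x 1ℚ)) u w ≡ true)
edge-fate G x optimal u w uw
  with bool-cases (level G x 1ℚ u) | bool-cases (level G x 1ℚ w)
... | inj₁ u∈I₁ | _         = inj₁ u∈I₁
... | inj₂ _    | inj₁ w∈I₁ = inj₂ (inj₁ w∈I₁)
... | inj₂ u∉I₁ | inj₂ w∉I₁
  with bool-cases (level G x 0ℚ u) | bool-cases (level G x 0ℚ w)
...   | inj₁ u∈I₀ | _ with () ← trans (≡-sym w∉I₁) (I₀-neighbour-in-I₁ G x optimal u w uw u∈I₀)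
...   | inj₂ _    | inj₁ w∈I₀
        with () ← trans (≡-sym u∉I₁)
                    (I₀-neighbour-in-I₁ G x optimal w u (trans (sym G w u) uw) w∈I₀)
...   | inj₂ u∉I₀ | inj₂ w∉I₀ = inj₂ (inj₂ (edge-survives G (level G x 0ℚ ∪ level G x 1ℚ) u w uw
                                  (cong₂ _∨_ u∉I₀ u∉I₁) (cong₂ _∨_ w∉I₀ w∉I₁)))

cover-extends : ∀ {n} (G : Graph n) (x : Point n) → Optimal G x → ∀ (R : VSet n) →
                VertexCover (G ∖ (level G x 0ℚ ∪ level G x 1ℚ)) R →
                VertexCover G (R ∪ level G x 1ℚ)
cover-extends G x optimal R (R⊆G′ , R-covers) = inside , covers
  where
  inside : ∀ w → (R ∪ level G x 1ℚ) w ≡ true → V G w ≡ true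
  inside w w∈ with ∨-true-cases (R w) w∈
  ... | inj₁ w∈R  = ∧-trueˡ (R⊆G′ w w∈R)
  ... | inj₂ w∈I₁ = ∧-trueˡ w∈I₁
  covers : ∀ u w → E G u w ≡ true → (R ∪ level G x 1ℚ) u ∨ (R ∪ level G x 1ℚ) w ≡ true
  covers u w uw with edge-fate G x optimal u w uw
  ... | inj₁ u∈I₁ = ∨-trueˡ _ (∨-trueʳ (R u) u∈I₁)
  ... | inj₂ (inj₁ w∈I₁) = ∨-trueʳ (R u ∨ level G x 1ℚ u) (∨-trueʳ (R w) w∈I₁)
  ... | inj₂ (inj₂ uw′) with ∨-true-cases (R u) (R-covers u w uw′)
  ...   | inj₁ u∈R = ∨-trueˡ _ (∨-trueˡ _ u∈R)
  ...   | inj₂ w∈R = ∨-trueʳ (R u ∨ level G x 1ℚ u) (∨-trueˡ _ w∈R)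

lift-cycle : ∀ {n} (G : Graph n) (keep : VSet n) → OddCycle (induced G keep) → OddCycle G
lift-cycle G keep C = record
  { s = s C ; s≥1 = s≥1 C ; c = c C ; inj = inj C
  ; step = λ i → ∧-trueˡ (step C i) ; close = ∧-trueˡ (close C) }

restrict-feasible : ∀ {n} (G : Graph n) (x : Point n) (keep : VSet n) →
                    Feasible G x → Feasible (induced G keep) (restrict (induced G keep) x)
restrict-feasible G x keep (_ , nonneg , edges , cycles) = zero-off′ , nonneg′ , edges′ , cycles′
  where
  H : Graph _
  H = induced G keep

  restrict-in : ∀ {w} → V H w ≡ true → restrict H x w ≡ x w
  restrict-in w∈H rewrite w∈H = refl

  zero-off′ : ∀ w → V H w ≡ false → restrict H x w ≡ 0ℚ
  zero-off′ w w∉H rewrite w∉H = refl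

  nonneg′ : ∀ w → V H w ≡ true → 0ℚ ≤ restrict H x w
  nonneg′ w w∈H rewrite w∈H = nonneg w (∧-trueˡ w∈H)

  edges′ : ∀ a b → E H a b ≡ true → 1ℚ ≤ restrict H x a + restrict H x b
  edges′ a b ab = subst₂ (λ p q → 1ℚ ≤ p + q)
    (≡-sym (restrict-in (proj₁ (closed H a b ab)))) (≡-sym (restrict-in (proj₂ (closed H a b ab))))
    (edges a b (∧-trueˡ ab))

  cycles′ : ∀ (C : OddCycle H) → ℕ→ℚ (suc (s C)) ≤ Σℚ (λ i → restrict H x (c C i))
  cycles′ C = subst (ℕ→ℚ (suc (s C)) ≤_) (Σ-cong (λ i → ≡-sym (restrict-in (cycle-vertex H C i))))
    (cycles (lift-cycle G keep C))

obj-restrict : ∀ {n} (H : Graph n) (x : Point n) → obj H (restrict H x) ≡ obj H x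
obj-restrict H x = Σ-cong pointwise
  where
  pointwise : ∀ w → restrict H (restrict H x) w ≡ restrict H x w
  pointwise w with V H w
  ... | true  = refl
  ... | false = refl

obj-split : ∀ {n} (G : Graph n) (x : Point n) →
            obj G x ≡ obj (G ∖ (level G x 0ℚ ∪ level G x 1ℚ)) x + ℕ→ℚ (count (level G x 1ℚ))
obj-split G x = begin
  Σℚ (restrict G x)                                ≡⟨ Σ-cong pointwise ⟩
  Σℚ (λ w → restrict G′ x w + indicator w)         ≡⟨ Σ-+ (restrict G′ x) indicator ⟩
  Σℚ (restrict G′ x) + Σℚ indicator                ≡⟨ cong (obj G′ x +_) (≡-sym (count-Σ I₁)) ⟩
  obj G′ x + ℕ→ℚ (count I₁)                        ∎
  where
  open ≡-Reasoning
  I₁ : VSet _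
  I₁ = level G x 1ℚ
  G′ : Graph _
  G′ = G ∖ (level G x 0ℚ ∪ I₁)
  indicator : Point _
  indicator w = if I₁ w then 1ℚ else 0ℚ
  -- a vertex contributes 0 if it is off G or in I₀, 1 if in I₁, and x w otherwise
  pointwise : ∀ w → restrict G x w ≡ restrict G′ x w + indicator w
  pointwise w with V G w
  ... | false = refl
  ... | true with x w ℚP.≟ 0ℚ | x w ℚP.≟ 1ℚ
  ...   | yes xw≡0 | yes xw≡1 with () ← trans (≡-sym xw≡0) xw≡1
  ...   | yes xw≡0 | no  _    = trans xw≡0 (≡-sym (ℚP.+-identityʳ 0ℚ))
  ...   | no  _    | yes xw≡1 = trans xw≡1 (≡-sym (ℚP.+-identityˡ 1ℚ))
  ...   | no  _    | no  _    = ≡-sym (ℚP.+-identityʳ (x w))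

-- Second claim of the lemma: an optimum of ELP(G ∖ (I₀ ∪ I₁)) is at most z(x) − |I₁|,
-- witnessed by the restriction of x.
objective-drop : ∀ {n} (G : Graph n) (x x́ : Point n) → Feasible G x →
                 Optimal (G ∖ (level G x 0ℚ ∪ level G x 1ℚ)) x́ →
                 obj (G ∖ (level G x 0ℚ ∪ level G x 1ℚ)) x́ ≤ obj G x - ℕ→ℚ (count (level G x 1ℚ))
objective-drop G x x́ feasible (_ , minimal) = begin
  obj G′ x́                     ≤⟨ minimal (restrict G′ x) (restrict-feasible G x keep feasible) ⟩
  obj G′ (restrict G′ x)       ≡⟨ obj-restrict G′ x ⟩
  obj G′ x                     ≡⟨ //-rightDividesʳ k (obj G′ x) ⟨
  (obj G′ x + k) - k           ≡⟨ cong (_- k) (obj-split G x) ⟨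
  obj G x - k                  ∎
  where
  open ℚP.≤-Reasoning
  keep : VSet _
  keep w = not ((level G x 0ℚ ∪ level G x 1ℚ) w)
  G′ : Graph _
  G′ = induced G keep
  k : ℚ
  k = ℕ→ℚ (count (level G x 1ℚ))

-- Lemma 6: only optimality of x⁰ and x́ is used, not that they are basic.
lemma6 : ∀ (n : ℕ) (G : Graph n) (x⁰ : Point n) → OptimalBFS G x⁰ →
         ∀ (x́ : Point n) → OptimalBFS (G ∖ (level G x⁰ 0ℚ ∪ level G x⁰ 1ℚ)) x́ →
         (∀ (R : VSet n) → VertexCover (G ∖ (level G x⁰ 0ℚ ∪ level G x⁰ 1ℚ)) R →
            VertexCover G (R ∪ level G x⁰ 1ℚ))
         × (obj (G ∖ (level G x⁰ 0ℚ ∪ level G x⁰ 1ℚ)) x́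
            ≤ obj G x⁰ - ℕ→ℚ (count (level G x⁰ 1ℚ)))
lemma6 n G x⁰ (_ , x⁰-optimal) x́ (_ , x́-optimal) =
  cover-extends G x⁰ x⁰-optimal , objective-drop G x⁰ x́ (proj₁ x⁰-optimal) x́-optimal
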